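{- For all closed terms $P,Q\in\mathcal{SP}_A$: $\mathrm{EqC\ell FEL}_2\vdash P=Q$ if and only if $\mathit{clfe}(P)=\mathit{clfe}(Q)$. (That is, the logic $\mathrm{C\ell FEL}_2$, defined by $\mathrm{C\ell FEL}_2\models P=Q\iff\mathit{clfe}(P)=\mathit{clfe}(Q)$, is axiomatised by $\mathrm{EqC\ell FEL}_2$.)
   Context: Let $A$ be a countable set of atoms, totally ordered as $a_1<a_2<\cdots$. $\mathcal{SP}_A$: closed terms generated by $P::=\mathsf T\mid\mathsf F\mid a\mid \neg P\mid P\mathbin{\wedge_\bullet}P\mid P\mathbin{\vee_\bullet}P$ ($a\in A$). The alphabet $\alpha(P)\subseteq A$ is the set of atoms occurring in $P$. For a string $\beta$ over $A$ with strictly increasing letters, $\widetilde{\mathsf F}_\beta$ is defined by $\widetilde{\mathsf F}_\epsilon=\mathsf F$, $\widetilde{\mathsf F}_{a\rho}=a\mathbin{\wedge_\bullet}\widetilde{\mathsf F}_\rho$. $\mathcal T_A$: $\mathsf T,\mathsf F\in\mathcal T_A$ and $(X\trianglelefteq a\trianglerighteq Y)\in\mathcal T_A$. Leaf replacement $X[\mathsf T\mapsto Y,\mathsf F\mapsto Z]$ replaces leaves $\mathsf T$ by $Y$ and $\mathsf F$ by $Z$; omitted replacements are identities. $\mathit{fe}(\mathsf T)=\mathsf T$, $\mathit{fe}(\mathsf F)=\mathsf F$, $\mathit{fe}(a)=\mathsf T\trianglelefteq a\trianglerighteq\mathsf F$, $\mathit{fe}(\neg P)=\mathit{fe}(P)[\mathsf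 T\mapsto\mathsf F,\mathsf F\mapsto\mathsf T]$, $\mathit{fe}(P\mathbin{\wedge_\bullet}Q)=\mathit{fe}(P)[\mathsf T\mapsto\mathit{fe}(Q),\mathsf F\mapsto\mathit{fe}(Q)[\mathsf T\mapsto\mathsf F]]$, $\mathit{fe}(P\mathbin{\vee_\bullet}Q)=\mathit{fe}(P)[\mathsf T\mapsto\mathit{fe}(Q)[\mathsf F\mapsto\mathsf T],\mathsf F\mapsto\mathit{fe}(Q)]$. $L_a(B)=R_a(B)=B$ for leaves; $L_a(X\trianglelefteq b\trianglerighteq Y)=L_a(X)$ if $b=a$, else $L_a(X)\trianglelefteq b\trianglerighteq L_a(Y)$; $R_a(X\trianglelefteq b\trianglerighteq Y)=R_a(Y)$ if $b=a$, else $R_a(X)\trianglelefteq b\trianglerighteq R_a(Y)$; $m(B)=B$, $m(X\trianglelefteq a\trianglerighteq Y)=m(L_a(X))\trianglelefteq a\trianglerighteq m(R_a(Y))$; $\mathit{mfe}(P)=m(\mathit{fe}(P))$. Finally $\mathit{clfe}(P)=\mathit{mfe}(\widetilde{\mathsf F}_\beta\mathbin{\vee_\bullet}P)$ where $\beta$ is the strictly increasing string whose set of letters is $\alpha(P)$. $\mathrm{EqFFEL}$: $\mathsf F=\neg\mathsf T$; $x\mathbin{\vee_\bullet}y=\neg(\neg x\mathbin{\wedge_\bullet}\neg y)$; $\neg\neg x=x$; $(x\mathbin{\wedge_\bullet}y)\mathbin{\wedge_\bullet}z=x\mathbin{\wedge_\bullet}(y\mathbin{\wedge_\bullet}z)$;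 $\mathsf T\mathbin{\wedge_\bullet}x=x$; $x\mathbin{\wedge_\bullet}\mathsf T=x$; $x\mathbin{\wedge_\bullet}\mathsf F=\mathsf F\mathbin{\wedge_\bullet}x$; $\neg x\mathbin{\wedge_\bullet}\mathsf F=x\mathbin{\wedge_\bullet}\mathsf F$; $(x\mathbin{\wedge_\bullet}\mathsf F)\mathbin{\vee_\bullet}y=(x\mathbin{\vee_\bullet}\mathsf T)\mathbin{\wedge_\bullet}y$; $x\mathbin{\vee_\bullet}(y\mathbin{\wedge_\bullet}\mathsf F)=x\mathbin{\wedge_\bullet}(y\mathbin{\vee_\bullet}\mathsf T)$. $\mathrm{EqC\ell FEL}_2=\mathrm{EqFFEL}\cup\{(x\mathbin{\vee_\bullet}y)\mathbin{\wedge_\bullet}z=(\neg x\mathbin{\wedge_\bullet}(y\mathbin{\wedge_\bullet}z))\mathbin{\vee_\bullet}(x\mathbin{\wedge_\bullet}z),\ x\mathbin{\wedge_\bullet}y=y\mathbin{\wedge_\bullet}x\}$. $\vdash$ is derivability in equational logic. -}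

module Defs where

open import Data.Nat using (ℕ; zero; suc; _+_; _⊔_; _≡ᵇ_)
open import Data.Bool using (Bool; true; false; _∨_; if_then_else_)
open import Data.List using (List; []; _∷_; upTo)
open import Data.Empty using (⊥)
open import Relation.Binary.PropositionalEquality using (_≡_)

-- Atoms: A = ℕ, with a_i ordered as the natural numbers (countable, total order).
Atom : Set
Atom = ℕ

-- Terms over a set V of variables (variables are needed for equational logic).
data Term (V : Set) : Set where
  var  : V → Term V
  T F  : Term V
  atom : Atom → Term V
  ¬'   : Term V → Term V
  _∧•_ _∨•_ : Term V → Term V → Term V

infixr 6 _∧•_
infixr 5 _∨•_

SP : Set
SP = Term ⊥

OTerm : Set
OTerm = Term ℕ

_[_] : {V W : Set} → Term V → (V → Term W) → Term W
var x [ σ ] = σ x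
T [ σ ] = T
F [ σ ] = F
atom a [ σ ] = atom a
¬' p [ σ ] = ¬' (p [ σ ])
(p ∧• q) [ σ ] = (p [ σ ]) ∧• (q [ σ ])
(p ∨• q) [ σ ] = (p [ σ ]) ∨• (q [ σ ])

embed : SP → OTerm
embed p = p [ (λ ()) ]

x y z : OTerm
x = var 0
y = var 1
z = var 2

data EqFFEL : OTerm → OTerm → Set where
  F1 : EqFFEL F (¬' T)
  F2 : EqFFEL (x ∨• y) (¬' (¬' x ∧• ¬' y))
  F3 : EqFFEL (¬' (¬' x)) x
  F4 : EqFFEL ((x ∧• y) ∧• z) (x ∧• (y ∧• z))
  F5 : EqFFEL (T ∧• x) x
  F6 : EqFFEL (x ∧• T) x
  F7 : EqFFEL (x ∧• F) (F ∧• x)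
  F8 : EqFFEL (¬' x ∧• F) (x ∧• F)
  F9 : EqFFEL ((x ∧• F) ∨• y) ((x ∨• T) ∧• y)
  F10 : EqFFEL (x ∨• (y ∧• F)) (x ∧• (y ∨• T))

data EqCℓFEL₂ : OTerm → OTerm → Set where
  ffel  : ∀ {s t} → EqFFEL s t → EqCℓFEL₂ s t
  CFEL1 : EqCℓFEL₂ ((x ∨• y) ∧• z) ((¬' x ∧• (y ∧• z)) ∨• (x ∧• z))
  CFEL2 : EqCℓFEL₂ (x ∧• y) (y ∧• x)

data _⊢_≈_ (E : OTerm → OTerm → Set) : OTerm → OTerm → Set where
  ax     : ∀ {s t} (σ : ℕ → OTerm) → E s t → E ⊢ (s [ σ ]) ≈ (t [ σ ])
  refl'  : ∀ {s} → E ⊢ s ≈ s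
  sym'   : ∀ {s t} → E ⊢ s ≈ t → E ⊢ t ≈ s
  trans' : ∀ {s t u} → E ⊢ s ≈ t → E ⊢ t ≈ u → E ⊢ s ≈ u
  cong¬  : ∀ {s t} → E ⊢ s ≈ t → E ⊢ ¬' s ≈ ¬' t
  cong∧  : ∀ {s t s' t'} → E ⊢ s ≈ t → E ⊢ s' ≈ t' → E ⊢ (s ∧• s') ≈ (t ∧• t')
  cong∨  : ∀ {s t s' t'} → E ⊢ s ≈ t → E ⊢ s' ≈ t' → E ⊢ (s ∨• s') ≈ (t ∨• t')

data Tree : Set where
  Tl Fl : Tree
  node  : Tree → Atom → Tree → Tree   -- node X a Y  =  X ⊴ a ⊵ Y

repl : Tree → Tree → Tree → Tree
repl Tl Y Z = Y
repl Fl Y Z = Z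
repl (node X a X') Y Z = node (repl X Y Z) a (repl X' Y Z)

fe : SP → Tree
fe (var ())
fe T = Tl
fe F = Fl
fe (atom a) = node Tl a Fl
fe (¬' P) = repl (fe P) Fl Tl
fe (P ∧• Q) = repl (fe P) (fe Q) (repl (fe Q) Fl Fl)
fe (P ∨• Q) = repl (fe P) (repl (fe Q) Tl Tl) (fe Q)

L R : Atom → Tree → Tree
L a Tl = Tl
L a Fl = Fl
L a (node X b Y) = if a ≡ᵇ b then L a X else node (L a X) b (L a Y)
R a Tl = Tl
R a Fl = Fl
R a (node X b Y) = if a ≡ᵇ b then R a Y else node (R a X) b (R a Y)

-- m is defined by recursion on the depth of the tree (L_a, R_a never
-- increase depth); 'm-fuel n' agrees with the paper's m on trees of depth ≤ n.
depth : Tree → ℕ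
depth Tl = 0
depth Fl = 0
depth (node X a Y) = suc (depth X ⊔ depth Y)

m-fuel : ℕ → Tree → Tree
m-fuel _ Tl = Tl
m-fuel _ Fl = Fl
m-fuel zero (node X a Y) = node X a Y   -- unreachable when fuel ≥ depth
m-fuel (suc n) (node X a Y) = node (m-fuel n (L a X)) a (m-fuel n (R a Y))

m : Tree → Tree
m X = m-fuel (depth X) X

mfe : SP → Tree
mfe P = m (fe P)

occurs : Atom → SP → Bool
occurs a (var ())
occurs a T = false
occurs a F = false
occurs a (atom b) = a ≡ᵇ b
occurs a (¬' P) = occurs a P
occurs a (P ∧• Q) = occurs a P ∨ occurs a Q
occurs a (P ∨• Q) = occurs a P ∨ occurs a Q

maxAtom : SP → ℕ
maxAtom (var ())
maxAtom T = 0
maxAtom F = 0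
maxAtom (atom b) = b
maxAtom (¬' P) = maxAtom P
maxAtom (P ∧• Q) = maxAtom P ⊔ maxAtom Q
maxAtom (P ∨• Q) = maxAtom P ⊔ maxAtom Q

keep : SP → List Atom → List Atom
keep P [] = []
keep P (a ∷ as) = if occurs a P then a ∷ keep P as else keep P as

β : SP → List Atom
β P = keep P (upTo (suc (maxAtom P)))

F̃ : List Atom → SP
F̃ [] = F
F̃ (a ∷ ρ) = atom a ∧• F̃ ρ

clfe : SP → Tree
clfe P = mfe (F̃ (β P) ∨• P)

-- Both sides of the equivalence say that P and Q have the same alphabet and the
-- same Boolean function (P ≃ Q below).  Derivable equations preserve both, since
-- EqCℓFEL₂ holds in the two-valued model and in the model recording whether a
-- given atom occurs.  Conversely, an atom a occurring in P may be added as an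
-- effect, eff a ∨ P ≈ P, and eff a ∨ P expands to (a ∧ P[a:=T]) ∨ (¬a ∧ P[a:=F]);
-- iterating over the alphabet yields a Shannon normal form that depends only on
-- the alphabet and the Boolean function.  On the tree side, prefixing F̃_β makes
-- the atoms of β(P) be evaluated first, in increasing order, so memorising turns
-- clfe(P) into the complete decision tree over β(P) whose leaves are the values
-- of P; this tree determines, and is determined by, the alphabet and the Boolean
-- function of P.

module Submission where

open import Defs
open import Data.Product using (_×_)
open import Relation.Binary.PropositionalEquality using (_≡_)

open import Algebra.Bundles using (IdempotentCommutativeMonoid)
open import Data.Bool using (Bool; true; false; not; _∧_; _∨_; if_then_else_)
import Data.Bool.Properties as 𝔹
open import Data.Empty using (⊥-elim)
open import Data.Bool.ListAction using (any)
open import Data.List using (List; []; _∷_; upTo)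
open import Data.List.Membership.Propositional.Properties using (∈-upTo⁺)
import Data.List.Relation.Unary.Any as Any
open import Data.List.Relation.Unary.Any.Properties using (any⁺)
open import Data.Maybe using (Maybe; just; nothing; fromMaybe; is-nothing)
open import Data.Nat using (ℕ; suc; _≡ᵇ_; _≤_; _<_; z≤n; s≤s)
open import Data.Nat.Properties using (_≟_; ≡⇒≡ᵇ; ≤-refl; ≤-trans; ≤-antisym; ⊔-lub; m≤m⊔n; m≤n⊔m; n≤1+n; ⊔-mono-≤)
open import Data.Product using (_,_)
open import Data.Sum using (_⊎_; inj₁; inj₂)
open import Function.Bundles using (Equivalence)
open import Relation.Binary.PropositionalEquality using (refl; sym; trans; cong; cong₂; _≢_)
open import Relation.Nullary.Decidable.Core using (proof)
open import Relation.Nullary.Reflects using (Reflects; ofʸ; ofⁿ)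
open import Relation.Binary.Bundles using (Setoid)
import Algebra.Solver.IdempotentCommutativeMonoid as ICM-Solver

≡ᵇ-reflects : ∀ a b → Reflects (a ≡ b) (a ≡ᵇ b)
≡ᵇ-reflects a b = proof (a ≟ b)

≡ᵇ-refl : ∀ a → (a ≡ᵇ a) ≡ true
≡ᵇ-refl a with a ≡ᵇ a | ≡ᵇ-reflects a a
... | true | _ = refl
... | false | ofⁿ a≢a = ⊥-elim (a≢a refl)

≡ᵇ-≢ : ∀ {a b} → a ≢ b → (a ≡ᵇ b) ≡ false
≡ᵇ-≢ {a} {b} a≢b with a ≡ᵇ b | ≡ᵇ-reflects a b
... | true | ofʸ a≡b = ⊥-elim (a≢b a≡b)
... | false | _ = refl

∨-introˡ : ∀ {u} v → u ≡ true → u ∨ v ≡ true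
∨-introˡ v refl = refl

∨-introʳ : ∀ u {v} → v ≡ true → u ∨ v ≡ true
∨-introʳ u refl = 𝔹.∨-zeroʳ u

∨-true⁻ : ∀ u {v} → u ∨ v ≡ true → u ≡ true ⊎ v ≡ true
∨-true⁻ true _ = inj₁ refl
∨-true⁻ false v≡true = inj₂ v≡true

infix 5 _∈ᵇ_
_∈ᵇ_ : Atom → List Atom → Bool
a ∈ᵇ S = any (a ≡ᵇ_) S

_[_↦_] : {A : Set} → (Atom → A) → Atom → A → Atom → A
(f [ a ↦ v ]) b = if a ≡ᵇ b then v else f b

[↦]-same : ∀ {A : Set} (f : Atom → A) a v → (f [ a ↦ v ]) a ≡ v
[↦]-same f a v rewrite ≡ᵇ-refl a = refl

[↦]-other : ∀ {A : Set} (f : Atom → A) {a b} v → b ≢ a → (f [ a ↦ v ]) b ≡ f b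
[↦]-other f v b≢a rewrite ≡ᵇ-≢ (λ a≡b → b≢a (sym a≡b)) = refl

infix 4 _≋_
_≋_ : OTerm → OTerm → Set
s ≋ t = EqCℓFEL₂ ⊢ s ≈ t

≋-setoid : Setoid _ _
≋-setoid = record
  { Carrier = OTerm ; _≈_ = _≋_
  ; isEquivalence = record { refl = refl' ; sym = sym' ; trans = trans' } }

open import Relation.Binary.Reasoning.Setoid ≋-setoid

⟨_,_,_⟩ : OTerm → OTerm → OTerm → ℕ → OTerm
⟨ p , q , r ⟩ 0 = p
⟨ p , q , r ⟩ 1 = q
⟨ p , q , r ⟩ 2 = r
⟨ p , q , r ⟩ _ = T

private variable p q r s p′ q′ : OTerm

-- p is evaluated for its side effects only.
eff : OTerm → OTerm
eff p = p ∧• F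

∧-congˡ : p ≋ p′ → p ∧• q ≋ p′ ∧• q
∧-congˡ e = cong∧ e refl'
∧-congʳ : q ≋ q′ → p ∧• q ≋ p ∧• q′
∧-congʳ e = cong∧ refl' e
∨-congˡ : p ≋ p′ → p ∨• q ≋ p′ ∨• q
∨-congˡ e = cong∨ e refl'
∨-congʳ : q ≋ q′ → p ∨• q ≋ p ∨• q′
∨-congʳ e = cong∨ refl' e

¬T≋F : ¬' T ≋ F
¬T≋F = sym' (ax ⟨ T , T , T ⟩ (ffel F1))

∨-as-∧ : p ∨• q ≋ ¬' (¬' p ∧• ¬' q)
∨-as-∧ {p} {q} = ax ⟨ p , q , T ⟩ (ffel F2)

¬-involutive : ¬' (¬' p) ≋ p
¬-involutive {p} = ax ⟨ p , T , T ⟩ (ffel F3)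

∧-assoc : (p ∧• q) ∧• r ≋ p ∧• (q ∧• r)
∧-assoc {p} {q} {r} = ax ⟨ p , q , r ⟩ (ffel F4)

∧-identityˡ : T ∧• p ≋ p
∧-identityˡ {p} = ax ⟨ p , T , T ⟩ (ffel F5)

∧-identityʳ : p ∧• T ≋ p
∧-identityʳ {p} = ax ⟨ p , T , T ⟩ (ffel F6)

eff-¬ : eff (¬' p) ≋ eff p
eff-¬ {p} = ax ⟨ p , T , T ⟩ (ffel F8)

eff-∨-shift : eff p ∨• q ≋ (p ∨• T) ∧• q
eff-∨-shift {p} {q} = ax ⟨ p , q , T ⟩ (ffel F9)

∨-∧-unfold : (p ∨• q) ∧• r ≋ (¬' p ∧• (q ∧• r)) ∨• (p ∧• r)
∨-∧-unfold {p} {q} {r} = ax ⟨ p , q , r ⟩ CFEL1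

∧-comm : p ∧• q ≋ q ∧• p
∧-comm {p} {q} = ax ⟨ p , q , T ⟩ CFEL2

¬F≋T : ¬' F ≋ T
¬F≋T = trans' (cong¬ (sym' ¬T≋F)) ¬-involutive

¬-distrib-∧ : ¬' (p ∧• q) ≋ ¬' p ∨• ¬' q
¬-distrib-∧ = sym' (trans' ∨-as-∧ (cong¬ (cong∧ ¬-involutive ¬-involutive)))

¬-distrib-∨ : ¬' (p ∨• q) ≋ ¬' p ∧• ¬' q
¬-distrib-∨ = trans' (cong¬ ∨-as-∧) ¬-involutive

∨-comm : p ∨• q ≋ q ∨• p
∨-comm = trans' ∨-as-∧ (trans' (cong¬ ∧-comm) (sym' ∨-as-∧))

∨-assoc : (p ∨• q) ∨• r ≋ p ∨• (q ∨• r)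
∨-assoc {p} {q} {r} = begin
  (p ∨• q) ∨• r                 ≈⟨ ∨-as-∧ ⟩
  ¬' (¬' (p ∨• q) ∧• ¬' r)      ≈⟨ cong¬ (∧-congˡ ¬-distrib-∨) ⟩
  ¬' ((¬' p ∧• ¬' q) ∧• ¬' r)   ≈⟨ cong¬ ∧-assoc ⟩
  ¬' (¬' p ∧• (¬' q ∧• ¬' r))   ≈⟨ cong¬ (∧-congʳ ¬-distrib-∨) ⟨
  ¬' (¬' p ∧• ¬' (q ∨• r))      ≈⟨ ∨-as-∧ ⟨
  p ∨• (q ∨• r)                 ∎

∨-identityˡ : F ∨• p ≋ p
∨-identityˡ = trans' ∨-as-∧ (trans' (cong¬ (trans' (∧-congˡ ¬F≋T) ∧-identityˡ)) ¬-involutive)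

∨-identityʳ : p ∨• F ≋ p
∨-identityʳ = trans' ∨-comm ∨-identityˡ

∨-unfold : p ∨• q ≋ (¬' p ∧• q) ∨• p
∨-unfold {p} {q} = begin
  p ∨• q                           ≈⟨ ∧-identityʳ ⟨
  (p ∨• q) ∧• T                    ≈⟨ ∨-∧-unfold ⟩
  (¬' p ∧• (q ∧• T)) ∨• (p ∧• T)   ≈⟨ cong∨ (∧-congʳ ∧-identityʳ) ∧-identityʳ ⟩
  (¬' p ∧• q) ∨• p                 ∎

∧-unfold : p ∧• q ≋ (¬' p ∨• q) ∧• p
∧-unfold {p} {q} = begin
  p ∧• q                                  ≈⟨ ¬-involutive ⟨
  ¬' (¬' (p ∧• q))                        ≈⟨ cong¬ ¬-distrib-∧ ⟩
  ¬' (¬' p ∨• ¬' q)                       ≈⟨ cong¬ ∨-unfold ⟩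
  ¬' ((¬' (¬' p) ∧• ¬' q) ∨• ¬' p)        ≈⟨ ¬-distrib-∨ ⟩
  ¬' (¬' (¬' p) ∧• ¬' q) ∧• ¬' (¬' p)     ≈⟨ cong∧ ¬-distrib-∧ ¬-involutive ⟩
  (¬' (¬' (¬' p)) ∨• ¬' (¬' q)) ∧• p      ≈⟨ ∧-congˡ (cong∨ ¬-involutive ¬-involutive) ⟩
  (¬' p ∨• q) ∧• p                        ∎

eff-absorbs : eff p ∨• p ≋ p
eff-absorbs {p} = sym' (begin
  p                                ≈⟨ ∨-identityʳ ⟨
  p ∨• F                           ≈⟨ ∨-unfold ⟩
  eff (¬' p) ∨• p                  ≈⟨ ∨-congˡ eff-¬ ⟩
  eff p ∨• p                       ∎)

∨T≋¬∨ : p ∨• T ≋ ¬' p ∨• p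
∨T≋¬∨ = trans' ∨-unfold (∨-congˡ ∧-identityʳ)

∧-idem : p ∧• p ≋ p
∧-idem {p} = begin
  p ∧• p              ≈⟨ ∧-unfold ⟩
  (¬' p ∨• p) ∧• p    ≈⟨ ∧-congˡ ∨T≋¬∨ ⟨
  (p ∨• T) ∧• p       ≈⟨ eff-∨-shift ⟨
  eff p ∨• p          ≈⟨ eff-absorbs ⟩
  p                   ∎

∨-idem : p ∨• p ≋ p
∨-idem = trans' ∨-as-∧ (trans' (cong¬ ∧-idem) ¬-involutive)

eff≋¬∧ : eff p ≋ ¬' p ∧• p
eff≋¬∧ = trans' ∧-unfold (∧-congˡ ∨-identityʳ)

∧-idempotentCommutativeMonoid : IdempotentCommutativeMonoid _ _
∧-idempotentCommutativeMonoid = record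
  { Carrier = OTerm ; _≈_ = _≋_ ; _∙_ = _∧•_ ; ε = T
  ; isIdempotentCommutativeMonoid = record
    { isCommutativeMonoid = record
      { isMonoid = record
        { isSemigroup = record
          { isMagma = record { isEquivalence = Setoid.isEquivalence ≋-setoid ; ∙-cong = cong∧ }
          ; assoc = λ _ _ _ → ∧-assoc }
        ; identity = (λ _ → ∧-identityˡ) , (λ _ → ∧-identityʳ) }
      ; comm = λ _ _ → ∧-comm }
    ; idem = λ _ → ∧-idem } }

∨-idempotentCommutativeMonoid : IdempotentCommutativeMonoid _ _
∨-idempotentCommutativeMonoid = record
  { Carrier = OTerm ; _≈_ = _≋_ ; _∙_ = _∨•_ ; ε = F
  ; isIdempotentCommutativeMonoid = record
    { isCommutativeMonoid = record
      { isMonoid = record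
        { isSemigroup = record
          { isMagma = record { isEquivalence = Setoid.isEquivalence ≋-setoid ; ∙-cong = cong∨ }
          ; assoc = λ _ _ _ → ∨-assoc }
        ; identity = (λ _ → ∨-identityˡ) , (λ _ → ∨-identityʳ) }
      ; comm = λ _ _ → ∨-comm }
    ; idem = λ _ → ∨-idem } }

module ∧-Solver = ICM-Solver ∧-idempotentCommutativeMonoid
module ∨-Solver = ICM-Solver ∨-idempotentCommutativeMonoid

∧-interchange : (p ∧• q) ∧• (r ∧• s) ≋ (p ∧• r) ∧• (q ∧• s)
∧-interchange {p} {q} {r} {s} =
  solve 4 (λ p q r s → (p ⊕ q) ⊕ (r ⊕ s) ⊜ (p ⊕ r) ⊕ (q ⊕ s)) refl' p q r s
  where open ∧-Solver

∨-interchange : (p ∨• q) ∨• (r ∨• s) ≋ (p ∨• r) ∨• (q ∨• s)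
∨-interchange {p} {q} {r} {s} =
  solve 4 (λ p q r s → (p ⊕ q) ⊕ (r ⊕ s) ⊜ (p ⊕ r) ⊕ (q ⊕ s)) refl' p q r s
  where open ∨-Solver

eff-∧ : eff (p ∧• q) ≋ eff p ∧• eff q
eff-∧ {p} {q} = solve 3 (λ p q f → (p ⊕ q) ⊕ f ⊜ (p ⊕ f) ⊕ (q ⊕ f)) refl' p q F
  where open ∧-Solver

eff-∨ : eff (p ∨• q) ≋ eff p ∧• eff q
eff-∨ {p} {q} = begin
  eff (p ∨• q)                  ≈⟨ ∧-congˡ ∨-as-∧ ⟩
  eff (¬' (¬' p ∧• ¬' q))       ≈⟨ eff-¬ ⟩
  eff (¬' p ∧• ¬' q)            ≈⟨ eff-∧ ⟩
  eff (¬' p) ∧• eff (¬' q)      ≈⟨ cong∧ eff-¬ eff-¬ ⟩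
  eff p ∧• eff q                ∎

eff-¬∧ : eff (¬' p ∧• q) ≋ eff (p ∧• q)
eff-¬∧ = trans' eff-∧ (trans' (∧-congˡ eff-¬) (sym' eff-∧))

∨-eff : eff p ∨• eff q ≋ eff (p ∧• q)
∨-eff {p} {q} = begin
  eff p ∨• eff q                     ≈⟨ eff-∨-shift ⟩
  (p ∨• T) ∧• (q ∧• F)               ≈⟨ solve 3 (λ u q f → u ⊕ (q ⊕ f) ⊜ (u ⊕ f) ⊕ q) refl' (p ∨• T) q F ⟩
  eff (p ∨• T) ∧• q                  ≈⟨ ∧-congˡ eff-∨ ⟩
  (eff p ∧• eff T) ∧• q              ≈⟨ solve 3 (λ p q f → ((p ⊕ f) ⊕ (id ⊕ f)) ⊕ q ⊜ (p ⊕ q) ⊕ f) refl' p q F ⟩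
  eff (p ∧• q)                       ∎
  where open ∧-Solver

eff-absorbs-∨ : eff p ∨• (p ∨• q) ≋ p ∨• q
eff-absorbs-∨ = trans' (sym' ∨-assoc) (∨-congˡ eff-absorbs)

∧-distribʳ-∨ : (p ∨• q) ∧• r ≋ (p ∧• r) ∨• (q ∧• r)
∧-distribʳ-∨ {p} {q} {r} = sym' (begin
  (p ∧• r) ∨• (q ∧• r)                                          ≈⟨ ∨-unfold ⟩
  (¬' (p ∧• r) ∧• (q ∧• r)) ∨• (p ∧• r)                         ≈⟨ ∨-congˡ (∧-congˡ ¬-distrib-∧) ⟩
  ((¬' p ∨• ¬' r) ∧• (q ∧• r)) ∨• (p ∧• r)                      ≈⟨ ∨-congˡ ∨-∧-unfold ⟩
  ((¬' (¬' p) ∧• (¬' r ∧• (q ∧• r))) ∨• W) ∨• (p ∧• r)          ≈⟨ ∨-congˡ (∨-congˡ vanishes) ⟩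
  (eff W ∨• W) ∨• (p ∧• r)                                      ≈⟨ ∨-assoc ⟩
  eff W ∨• (W ∨• (p ∧• r))                                      ≈⟨ eff-absorbs-∨ ⟩
  W ∨• (p ∧• r)                                                 ≈⟨ ∨-∧-unfold ⟨
  (p ∨• q) ∧• r                                                 ∎)
  where
  open ∧-Solver
  W = ¬' p ∧• (q ∧• r)
  vanishes : ¬' (¬' p) ∧• (¬' r ∧• (q ∧• r)) ≋ eff W
  vanishes = begin
    ¬' (¬' p) ∧• (¬' r ∧• (q ∧• r))    ≈⟨ ∧-congˡ ¬-involutive ⟩
    p ∧• (¬' r ∧• (q ∧• r))            ≈⟨ solve 4 (λ p n q r → p ⊕ (n ⊕ (q ⊕ r)) ⊜ (p ⊕ q) ⊕ (n ⊕ r)) refl' p (¬' r) q r ⟩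
    (p ∧• q) ∧• (¬' r ∧• r)            ≈⟨ ∧-congʳ eff≋¬∧ ⟨
    (p ∧• q) ∧• (r ∧• F)               ≈⟨ solve 4 (λ p q r f → (p ⊕ q) ⊕ (r ⊕ f) ⊜ (p ⊕ (q ⊕ r)) ⊕ f) refl' p q r F ⟩
    eff (p ∧• (q ∧• r))                ≈⟨ eff-¬∧ ⟨
    eff W                              ∎

∧-distribˡ-∨ : r ∧• (p ∨• q) ≋ (r ∧• p) ∨• (r ∧• q)
∧-distribˡ-∨ = trans' ∧-comm (trans' ∧-distribʳ-∨ (cong∨ ∧-comm ∧-comm))

∨¬≋∨T : p ∨• ¬' p ≋ p ∨• T
∨¬≋∨T = trans' ∨-comm (sym' ∨T≋¬∨)

-- Conditional composition and Shannon expansion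

infix 5 _◁_▷_
_◁_▷_ : OTerm → OTerm → OTerm → OTerm
X ◁ a ▷ Y = (a ∧• X) ∨• (¬' a ∧• Y)

private variable a X Y X′ Y′ : OTerm

expand-trivial : eff a ∨• X ≋ X ◁ a ▷ X
expand-trivial {a} {X} = begin
  eff a ∨• X              ≈⟨ eff-∨-shift ⟩
  (a ∨• T) ∧• X           ≈⟨ ∧-congˡ ∨¬≋∨T ⟨
  (a ∨• ¬' a) ∧• X        ≈⟨ ∧-distribʳ-∨ ⟩
  X ◁ a ▷ X               ∎

◁▷-∨ : (X ◁ a ▷ Y) ∨• (X′ ◁ a ▷ Y′) ≋ (X ∨• X′) ◁ a ▷ (Y ∨• Y′)
◁▷-∨ = trans' ∨-interchange (sym' (cong∨ ∧-distribˡ-∨ ∧-distribˡ-∨))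

∧-complementary : (a ∧• X) ∧• (¬' a ∧• Y) ≋ eff (a ∧• (X ∧• Y))
∧-complementary {a} {X} {Y} = begin
  (a ∧• X) ∧• (¬' a ∧• Y)    ≈⟨ ∧-interchange ⟩
  (a ∧• ¬' a) ∧• (X ∧• Y)    ≈⟨ ∧-congˡ (trans' ∧-comm (sym' eff≋¬∧)) ⟩
  eff a ∧• (X ∧• Y)          ≈⟨ solve 4 (λ a f x y → (a ⊕ f) ⊕ (x ⊕ y) ⊜ (a ⊕ (x ⊕ y)) ⊕ f) refl' a F X Y ⟩
  eff (a ∧• (X ∧• Y))        ∎
  where open ∧-Solver

◁▷-∧ : (X ◁ a ▷ Y) ∧• (X′ ◁ a ▷ Y′) ≋ (X ∧• X′) ◁ a ▷ (Y ∧• Y′)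
◁▷-∧ {X} {a} {Y} {X′} {Y′} = begin
  (U ∨• V) ∧• (U′ ∨• V′)                                   ≈⟨ ∧-distribʳ-∨ ⟩
  (U ∧• (U′ ∨• V′)) ∨• (V ∧• (U′ ∨• V′))                   ≈⟨ cong∨ ∧-distribˡ-∨ ∧-distribˡ-∨ ⟩
  ((U ∧• U′) ∨• (U ∧• V′)) ∨• ((V ∧• U′) ∨• (V ∧• V′))     ≈⟨ cong∨ (cong∨ ∧-interchange ∧-complementary)
                                                                    (cong∨ (trans' ∧-comm ∧-complementary) ∧-interchange) ⟩
  ((a ∧• a) ∧• (X ∧• X′) ∨• eff K₁) ∨•
    (eff K₂ ∨• (¬' a ∧• ¬' a) ∧• (Y ∧• Y′))                ≈⟨ cong∨ (∨-congˡ (∧-congˡ ∧-idem)) (∨-congʳ (∧-congˡ ∧-idem)) ⟩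
  (G₁ ∨• eff K₁) ∨• (eff K₂ ∨• G₂)                         ≈⟨ (let open ∨-Solver in
                                                                solve 4 (λ g₁ k₁ k₂ g₂ → (g₁ ⊕ k₁) ⊕ (k₂ ⊕ g₂) ⊜ (k₁ ⊕ k₂) ⊕ (g₁ ⊕ g₂))
                                                                  refl' G₁ (eff K₁) (eff K₂) G₂) ⟩
  (eff K₁ ∨• eff K₂) ∨• (G₁ ∨• G₂)                         ≈⟨ ∨-congˡ ∨-eff ⟩
  eff (K₁ ∧• K₂) ∨• (G₁ ∨• G₂)                             ≈⟨ ∨-congˡ same-effect ⟨
  eff (G₁ ∨• G₂) ∨• (G₁ ∨• G₂)                             ≈⟨ eff-absorbs ⟩
  G₁ ∨• G₂                                                 ∎
  where
  U = a ∧• X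
  V = ¬' a ∧• Y
  U′ = a ∧• X′
  V′ = ¬' a ∧• Y′
  G₁ = a ∧• (X ∧• X′)
  G₂ = ¬' a ∧• (Y ∧• Y′)
  K₁ = a ∧• (X ∧• Y′)
  K₂ = a ∧• (X′ ∧• Y)
  same-effect : eff (G₁ ∨• G₂) ≋ eff (K₁ ∧• K₂)
  same-effect = begin
    eff (G₁ ∨• G₂)                    ≈⟨ eff-∨ ⟩
    eff G₁ ∧• eff G₂                  ≈⟨ ∧-congʳ eff-¬∧ ⟩
    eff G₁ ∧• eff (a ∧• (Y ∧• Y′))    ≈⟨ solve 6 (λ a x x′ y y′ f →
                                            ((a ⊕ (x ⊕ x′)) ⊕ f) ⊕ ((a ⊕ (y ⊕ y′)) ⊕ f)
                                          ⊜ ((a ⊕ (x ⊕ y′)) ⊕ (a ⊕ (x′ ⊕ y))) ⊕ f) refl' a X X′ Y Y′ F ⟩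
    eff (K₁ ∧• K₂)                    ∎
    where open ∧-Solver

expand-∨ : eff a ∨• p ≋ X ◁ a ▷ Y → eff a ∨• q ≋ X′ ◁ a ▷ Y′ →
           eff a ∨• (p ∨• q) ≋ (X ∨• X′) ◁ a ▷ (Y ∨• Y′)
expand-∨ {a} {p} {X} {Y} {q} {X′} {Y′} ep eq = begin
  eff a ∨• (p ∨• q)                  ≈⟨ solve 3 (λ e p q → e ⊕ (p ⊕ q) ⊜ (e ⊕ p) ⊕ (e ⊕ q)) refl' (eff a) p q ⟩
  (eff a ∨• p) ∨• (eff a ∨• q)       ≈⟨ cong∨ ep eq ⟩
  (X ◁ a ▷ Y) ∨• (X′ ◁ a ▷ Y′)       ≈⟨ ◁▷-∨ ⟩
  (X ∨• X′) ◁ a ▷ (Y ∨• Y′)          ∎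
  where open ∨-Solver

expand-∧ : eff a ∨• p ≋ X ◁ a ▷ Y → eff a ∨• q ≋ X′ ◁ a ▷ Y′ →
           eff a ∨• (p ∧• q) ≋ (X ∧• X′) ◁ a ▷ (Y ∧• Y′)
expand-∧ {a} {p} {X} {Y} {q} {X′} {Y′} ep eq = begin
  eff a ∨• (p ∧• q)                        ≈⟨ eff-∨-shift ⟩
  (a ∨• T) ∧• (p ∧• q)                     ≈⟨ solve 3 (λ u p q → u ⊕ (p ⊕ q) ⊜ (u ⊕ p) ⊕ (u ⊕ q)) refl' (a ∨• T) p q ⟩
  ((a ∨• T) ∧• p) ∧• ((a ∨• T) ∧• q)       ≈⟨ cong∧ eff-∨-shift eff-∨-shift ⟨
  (eff a ∨• p) ∧• (eff a ∨• q)             ≈⟨ cong∧ ep eq ⟩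
  (X ◁ a ▷ Y) ∧• (X′ ◁ a ▷ Y′)             ≈⟨ ◁▷-∧ ⟩
  (X ∧• X′) ◁ a ▷ (Y ∧• Y′)                ∎
  where open ∧-Solver

expand-self : eff a ∨• a ≋ T ◁ a ▷ F
expand-self = trans' ∨-comm (sym' (cong∨ ∧-identityʳ eff-¬))

expand-¬self : eff a ∨• ¬' a ≋ ¬' T ◁ a ▷ ¬' F
expand-¬self = sym' (cong∨ (∧-congʳ ¬T≋F) (trans' (∧-congʳ ¬F≋T) ∧-identityʳ))

-- Soundness for the two-valued semantics and the alphabet

record Model : Set₁ where
  field
    Carrier : Set
    ⊤ᴹ ⊥ᴹ : Carrier
    atomᴹ : Atom → Carrier
    ¬ᴹ : Carrier → Carrier
    _∧ᴹ_ _∨ᴹ_ : Carrier → Carrier → Carrier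

module Semantics (M : Model) where
  open Model M

  ⟦_⟧ : {V : Set} → Term V → (V → Carrier) → Carrier
  ⟦ var v ⟧ ν = ν v
  ⟦ T ⟧ ν = ⊤ᴹ
  ⟦ F ⟧ ν = ⊥ᴹ
  ⟦ atom a ⟧ ν = atomᴹ a
  ⟦ ¬' p ⟧ ν = ¬ᴹ (⟦ p ⟧ ν)
  ⟦ p ∧• q ⟧ ν = ⟦ p ⟧ ν ∧ᴹ ⟦ q ⟧ ν
  ⟦ p ∨• q ⟧ ν = ⟦ p ⟧ ν ∨ᴹ ⟦ q ⟧ ν

  ⟦⟧-subst : {V W : Set} (p : Term V) (σ : V → Term W) (ν : W → Carrier) →
             ⟦ p [ σ ] ⟧ ν ≡ ⟦ p ⟧ (λ v → ⟦ σ v ⟧ ν)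
  ⟦⟧-subst (var v) σ ν = refl
  ⟦⟧-subst T σ ν = refl
  ⟦⟧-subst F σ ν = refl
  ⟦⟧-subst (atom a) σ ν = refl
  ⟦⟧-subst (¬' p) σ ν = cong ¬ᴹ (⟦⟧-subst p σ ν)
  ⟦⟧-subst (p ∧• q) σ ν = cong₂ _∧ᴹ_ (⟦⟧-subst p σ ν) (⟦⟧-subst q σ ν)
  ⟦⟧-subst (p ∨• q) σ ν = cong₂ _∨ᴹ_ (⟦⟧-subst p σ ν) (⟦⟧-subst q σ ν)

  ⟦embed⟧ : (P : SP) (ν : ℕ → Carrier) → ⟦ embed P ⟧ ν ≡ ⟦ P ⟧ (λ ())
  ⟦embed⟧ (var ())
  ⟦embed⟧ T ν = refl
  ⟦embed⟧ F ν = refl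
  ⟦embed⟧ (atom a) ν = refl
  ⟦embed⟧ (¬' P) ν = cong ¬ᴹ (⟦embed⟧ P ν)
  ⟦embed⟧ (P ∧• Q) ν = cong₂ _∧ᴹ_ (⟦embed⟧ P ν) (⟦embed⟧ Q ν)
  ⟦embed⟧ (P ∨• Q) ν = cong₂ _∨ᴹ_ (⟦embed⟧ P ν) (⟦embed⟧ Q ν)

  Satisfies : (OTerm → OTerm → Set) → Set
  Satisfies E = ∀ {s t} → E s t → ∀ ν → ⟦ s ⟧ ν ≡ ⟦ t ⟧ ν

  soundness : ∀ {E s t} → Satisfies E → E ⊢ s ≈ t → ∀ ν → ⟦ s ⟧ ν ≡ ⟦ t ⟧ ν
  soundness sat (ax {s} {t} σ e) ν = trans (⟦⟧-subst s σ ν) (trans (sat e _) (sym (⟦⟧-subst t σ ν)))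
  soundness sat refl' ν = refl
  soundness sat (sym' d) ν = sym (soundness sat d ν)
  soundness sat (trans' d d′) ν = trans (soundness sat d ν) (soundness sat d′ ν)
  soundness sat (cong¬ d) ν = cong ¬ᴹ (soundness sat d ν)
  soundness sat (cong∧ d d′) ν = cong₂ _∧ᴹ_ (soundness sat d ν) (soundness sat d′ ν)
  soundness sat (cong∨ d d′) ν = cong₂ _∨ᴹ_ (soundness sat d ν) (soundness sat d′ ν)

  closed-soundness : ∀ {E} → Satisfies E → (P Q : SP) → E ⊢ embed P ≈ embed Q →
                     ⟦ P ⟧ (λ ()) ≡ ⟦ Q ⟧ (λ ())
  closed-soundness sat P Q d =
    trans (sym (⟦embed⟧ P ν)) (trans (soundness sat d ν) (⟦embed⟧ Q ν))
    where ν = λ _ → ⊤ᴹ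

Valuation : Set
Valuation = Atom → Bool

boolModel : Valuation → Model
boolModel ρ = record
  { Carrier = Bool ; ⊤ᴹ = true ; ⊥ᴹ = false ; atomᴹ = ρ
  ; ¬ᴹ = not ; _∧ᴹ_ = _∧_ ; _∨ᴹ_ = _∨_ }

-- Computes whether a occurs; a model because no axiom of EqCℓFEL₂ deletes an atom.
occursModel : Atom → Model
occursModel a = record
  { Carrier = Bool ; ⊤ᴹ = false ; ⊥ᴹ = false ; atomᴹ = a ≡ᵇ_
  ; ¬ᴹ = λ u → u ; _∧ᴹ_ = _∨_ ; _∨ᴹ_ = _∨_ }

boolModel-satisfies : ∀ ρ → Semantics.Satisfies (boolModel ρ) EqCℓFEL₂
boolModel-satisfies ρ (ffel F1) ν = refl
boolModel-satisfies ρ (ffel F2) ν = de-Morgan (ν 0) (ν 1)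
  where
  de-Morgan : ∀ u v → u ∨ v ≡ not (not u ∧ not v)
  de-Morgan false v = sym (𝔹.not-involutive v)
  de-Morgan true v = refl
boolModel-satisfies ρ (ffel F3) ν = 𝔹.not-involutive (ν 0)
boolModel-satisfies ρ (ffel F4) ν = 𝔹.∧-assoc (ν 0) (ν 1) (ν 2)
boolModel-satisfies ρ (ffel F5) ν = refl
boolModel-satisfies ρ (ffel F6) ν = 𝔹.∧-identityʳ (ν 0)
boolModel-satisfies ρ (ffel F7) ν = 𝔹.∧-zeroʳ (ν 0)
boolModel-satisfies ρ (ffel F8) ν = trans (𝔹.∧-zeroʳ (not (ν 0))) (sym (𝔹.∧-zeroʳ (ν 0)))
boolModel-satisfies ρ (ffel F9) ν with ν 0
... | false = refl
... | true = refl
boolModel-satisfies ρ (ffel F10) ν with ν 0 | ν 1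
... | false | false = refl
... | false | true = refl
... | true | false = refl
... | true | true = refl
boolModel-satisfies ρ CFEL1 ν with ν 0
... | false = sym (𝔹.∨-identityʳ (ν 1 ∧ ν 2))
... | true = refl
boolModel-satisfies ρ CFEL2 ν = 𝔹.∧-comm (ν 0) (ν 1)

occursModel-satisfies : ∀ a → Semantics.Satisfies (occursModel a) EqCℓFEL₂
occursModel-satisfies a (ffel F1) ν = refl
occursModel-satisfies a (ffel F2) ν = refl
occursModel-satisfies a (ffel F3) ν = refl
occursModel-satisfies a (ffel F4) ν = 𝔹.∨-assoc (ν 0) (ν 1) (ν 2)
occursModel-satisfies a (ffel F5) ν = refl
occursModel-satisfies a (ffel F6) ν = 𝔹.∨-identityʳ (ν 0)
occursModel-satisfies a (ffel F7) ν = 𝔹.∨-identityʳ (ν 0)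
occursModel-satisfies a (ffel F8) ν = refl
occursModel-satisfies a (ffel F9) ν = refl
occursModel-satisfies a (ffel F10) ν = refl
occursModel-satisfies a CFEL1 ν with ν 0 | ν 1
... | false | false = sym (𝔹.∨-idem (ν 2))
... | false | true = refl
... | true | _ = refl
occursModel-satisfies a CFEL2 ν = 𝔹.∨-comm (ν 0) (ν 1)

eval : Valuation → SP → Bool
eval ρ P = ⟦ P ⟧ (λ ()) where open Semantics (boolModel ρ)

⟦⟧-occurs : ∀ a P → Semantics.⟦ occursModel a ⟧ P (λ ()) ≡ occurs a P
⟦⟧-occurs a (var ())
⟦⟧-occurs a T = refl
⟦⟧-occurs a F = refl
⟦⟧-occurs a (atom b) = refl
⟦⟧-occurs a (¬' P) = ⟦⟧-occurs a P
⟦⟧-occurs a (P ∧• Q) = cong₂ _∨_ (⟦⟧-occurs a P) (⟦⟧-occurs a Q)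
⟦⟧-occurs a (P ∨• Q) = cong₂ _∨_ (⟦⟧-occurs a P) (⟦⟧-occurs a Q)

infix 4 _≃_
record _≃_ (P Q : SP) : Set where
  field
    same-alphabet : ∀ a → occurs a P ≡ occurs a Q
    same-value : ∀ ρ → eval ρ P ≡ eval ρ Q
open _≃_

≋⇒≃ : ∀ P Q → embed P ≋ embed Q → P ≃ Q
≋⇒≃ P Q d .same-alphabet a = trans (sym (⟦⟧-occurs a P))
  (trans (Semantics.closed-soundness (occursModel a) (occursModel-satisfies a) P Q d) (⟦⟧-occurs a Q))
≋⇒≃ P Q d .same-value ρ = Semantics.closed-soundness (boolModel ρ) (boolModel-satisfies ρ) P Q d

≃-sym : ∀ {P Q} → P ≃ Q → Q ≃ P
≃-sym e .same-alphabet a = sym (e .same-alphabet a)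
≃-sym e .same-value ρ = sym (e .same-value ρ)

-- Completeness via Shannon normal forms

bool : Bool → SP
bool true = T
bool false = F

¬-bool : ∀ u → ¬' (embed (bool u)) ≋ embed (bool (not u))
¬-bool true = ¬T≋F
¬-bool false = ¬F≋T

∧-bool : ∀ u v → embed (bool u) ∧• embed (bool v) ≋ embed (bool (u ∧ v))
∧-bool true v = ∧-identityˡ
∧-bool false true = ∧-identityʳ
∧-bool false false = ∧-idem

∨-bool : ∀ u v → embed (bool u) ∨• embed (bool v) ≋ embed (bool (u ∨ v))
∨-bool false v = ∨-identityˡ
∨-bool true false = ∨-identityʳ
∨-bool true true = ∨-idem

occurs-bool : ∀ a v → occurs a (bool v) ≡ false
occurs-bool a true = refl
occurs-bool a false = refl

atomless≋value : ∀ ρ P → (∀ a → occurs a P ≡ false) → embed P ≋ embed (bool (eval ρ P))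
atomless≋value ρ (var ())
atomless≋value ρ T _ = refl'
atomless≋value ρ F _ = refl'
atomless≋value ρ (atom a) none with () ← trans (sym (≡ᵇ-refl a)) (none a)
atomless≋value ρ (¬' P) none = trans' (cong¬ (atomless≋value ρ P none)) (¬-bool (eval ρ P))
atomless≋value ρ (P ∧• Q) none =
  trans' (cong∧ (atomless≋value ρ P (λ a → 𝔹.∨-conicalˡ _ _ (none a)))
                (atomless≋value ρ Q (λ a → 𝔹.∨-conicalʳ _ _ (none a))))
         (∧-bool (eval ρ P) (eval ρ Q))
atomless≋value ρ (P ∨• Q) none =
  trans' (cong∨ (atomless≋value ρ P (λ a → 𝔹.∨-conicalˡ _ _ (none a)))
                (atomless≋value ρ Q (λ a → 𝔹.∨-conicalʳ _ _ (none a))))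
         (∨-bool (eval ρ P) (eval ρ Q))

∧-absorbs-either : a ∧• p ≋ p ⊎ a ∧• q ≋ q → a ∧• (p ∧• q) ≋ p ∧• q
∧-absorbs-either (inj₁ absorbs) = trans' (sym' ∧-assoc) (∧-congˡ absorbs)
∧-absorbs-either {a} {p} {q} (inj₂ absorbs) =
  trans' (solve 3 (λ a p q → a ⊕ (p ⊕ q) ⊜ p ⊕ (a ⊕ q)) refl' a p q) (∧-congʳ absorbs)
  where open ∧-Solver

either-occurs : ∀ a P Q → occurs a P ∨ occurs a Q ≡ true →
                atom a ∧• eff (embed P) ≋ eff (embed P) ⊎ atom a ∧• eff (embed Q) ≋ eff (embed Q)

∧-eff-occurring : ∀ a P → occurs a P ≡ true → atom a ∧• eff (embed P) ≋ eff (embed P)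
∧-eff-occurring a (var ())
∧-eff-occurring a (atom b) occ with a ≡ᵇ b | ≡ᵇ-reflects a b
... | true | ofʸ refl = solve 2 (λ a f → a ⊕ (a ⊕ f) ⊜ a ⊕ f) refl' (atom a) F
  where open ∧-Solver
∧-eff-occurring a (¬' P) occ =
  trans' (∧-congʳ eff-¬) (trans' (∧-eff-occurring a P occ) (sym' eff-¬))
∧-eff-occurring a (P ∧• Q) occ =
  trans' (∧-congʳ eff-∧) (trans' (∧-absorbs-either (either-occurs a P Q occ)) (sym' eff-∧))
∧-eff-occurring a (P ∨• Q) occ =
  trans' (∧-congʳ eff-∨) (trans' (∧-absorbs-either (either-occurs a P Q occ)) (sym' eff-∨))

either-occurs a P Q occ with ∨-true⁻ (occurs a P) occ
... | inj₁ inP = inj₁ (∧-eff-occurring a P inP)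
... | inj₂ inQ = inj₂ (∧-eff-occurring a Q inQ)

eff-∨-occurring : ∀ a P → occurs a P ≡ true → eff (atom a) ∨• embed P ≋ embed P
eff-∨-occurring a P occ = begin
  eff (atom a) ∨• t                    ≈⟨ ∨-congʳ eff-absorbs ⟨
  eff (atom a) ∨• (eff t ∨• t)         ≈⟨ ∨-assoc ⟨
  (eff (atom a) ∨• eff t) ∨• t         ≈⟨ ∨-congˡ (trans' ∨-eff ∧-assoc) ⟩
  (atom a ∧• eff t) ∨• t               ≈⟨ ∨-congˡ (∧-eff-occurring a P occ) ⟩
  eff t ∨• t                           ≈⟨ eff-absorbs ⟩
  t                                    ∎
  where t = embed P

_[_≔_] : SP → Atom → Bool → SP
var () [ a ≔ v ]
T [ a ≔ v ] = T
F [ a ≔ v ] = F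
atom b [ a ≔ v ] = if a ≡ᵇ b then bool v else atom b
¬' P [ a ≔ v ] = ¬' (P [ a ≔ v ])
(P ∧• Q) [ a ≔ v ] = P [ a ≔ v ] ∧• Q [ a ≔ v ]
(P ∨• Q) [ a ≔ v ] = P [ a ≔ v ] ∨• Q [ a ≔ v ]

eval-[≔] : ∀ ρ a v P → eval ρ (P [ a ≔ v ]) ≡ eval (ρ [ a ↦ v ]) P
eval-[≔] ρ a v (var ())
eval-[≔] ρ a v T = refl
eval-[≔] ρ a v F = refl
eval-[≔] ρ a true (atom b) with a ≡ᵇ b
... | true = refl
... | false = refl
eval-[≔] ρ a false (atom b) with a ≡ᵇ b
... | true = refl
... | false = refl
eval-[≔] ρ a v (¬' P) = cong not (eval-[≔] ρ a v P)
eval-[≔] ρ a v (P ∧• Q) = cong₂ _∧_ (eval-[≔] ρ a v P) (eval-[≔] ρ a v Q)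
eval-[≔] ρ a v (P ∨• Q) = cong₂ _∨_ (eval-[≔] ρ a v P) (eval-[≔] ρ a v Q)

occurs-[≔] : ∀ b a v P → occurs b (P [ a ≔ v ]) ≡ not (a ≡ᵇ b) ∧ occurs b P
occurs-[≔] b a v (var ())
occurs-[≔] b a v T = sym (𝔹.∧-zeroʳ _)
occurs-[≔] b a v F = sym (𝔹.∧-zeroʳ _)
occurs-[≔] b a v (atom c) with a ≡ᵇ c | ≡ᵇ-reflects a c | a ≡ᵇ b | ≡ᵇ-reflects a b
... | true | ofʸ refl | true | _ = occurs-bool b v
... | true | ofʸ refl | false | ofⁿ a≢b = trans (occurs-bool b v) (sym (≡ᵇ-≢ (λ b≡a → a≢b (sym b≡a))))
... | false | ofⁿ a≢c | true | ofʸ refl = ≡ᵇ-≢ a≢c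
... | false | _ | false | _ = refl
occurs-[≔] b a v (¬' P) = occurs-[≔] b a v P
occurs-[≔] b a v (P ∧• Q) =
  trans (cong₂ _∨_ (occurs-[≔] b a v P) (occurs-[≔] b a v Q)) (sym (𝔹.∧-distribˡ-∨ (not (a ≡ᵇ b)) _ _))
occurs-[≔] b a v (P ∨• Q) =
  trans (cong₂ _∨_ (occurs-[≔] b a v P) (occurs-[≔] b a v Q)) (sym (𝔹.∧-distribˡ-∨ (not (a ≡ᵇ b)) _ _))

≃-[≔] : ∀ {P Q} a v → P ≃ Q → P [ a ≔ v ] ≃ Q [ a ≔ v ]
≃-[≔] {P} {Q} a v P≃Q .same-alphabet b =
  trans (occurs-[≔] b a v P) (trans (cong (not (a ≡ᵇ b) ∧_) (P≃Q .same-alphabet b)) (sym (occurs-[≔] b a v Q)))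
≃-[≔] {P} {Q} a v P≃Q .same-value ρ =
  trans (eval-[≔] ρ a v P) (trans (P≃Q .same-value (ρ [ a ↦ v ])) (sym (eval-[≔] ρ a v Q)))

nnf nnf¬ : SP → SP
nnf (var ())
nnf T = T
nnf F = F
nnf (atom a) = atom a
nnf (¬' P) = nnf¬ P
nnf (P ∧• Q) = nnf P ∧• nnf Q
nnf (P ∨• Q) = nnf P ∨• nnf Q
nnf¬ (var ())
nnf¬ T = F
nnf¬ F = T
nnf¬ (atom a) = ¬' (atom a)
nnf¬ (¬' P) = nnf P
nnf¬ (P ∧• Q) = nnf¬ P ∨• nnf¬ Q
nnf¬ (P ∨• Q) = nnf¬ P ∧• nnf¬ Q

embed-nnf : ∀ P → embed P ≋ embed (nnf P)
embed-nnf¬ : ∀ P → ¬' (embed P) ≋ embed (nnf¬ P)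
embed-nnf (var ())
embed-nnf T = refl'
embed-nnf F = refl'
embed-nnf (atom a) = refl'
embed-nnf (¬' P) = embed-nnf¬ P
embed-nnf (P ∧• Q) = cong∧ (embed-nnf P) (embed-nnf Q)
embed-nnf (P ∨• Q) = cong∨ (embed-nnf P) (embed-nnf Q)
embed-nnf¬ (var ())
embed-nnf¬ T = ¬T≋F
embed-nnf¬ F = ¬F≋T
embed-nnf¬ (atom a) = refl'
embed-nnf¬ (¬' P) = trans' ¬-involutive (embed-nnf P)
embed-nnf¬ (P ∧• Q) = trans' ¬-distrib-∧ (cong∨ (embed-nnf¬ P) (embed-nnf¬ Q))
embed-nnf¬ (P ∨• Q) = trans' ¬-distrib-∨ (cong∧ (embed-nnf¬ P) (embed-nnf¬ Q))

-- Expansion is compositional for ∧ and ∨ (expand-∧, expand-∨) but not for ¬,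
-- hence it is proved for negation normal forms.
ShannonExpands : Atom → SP → Set
ShannonExpands a R = eff (atom a) ∨• embed R ≋ embed (R [ a ≔ true ]) ◁ atom a ▷ embed (R [ a ≔ false ])

shannon-nnf : ∀ a P → ShannonExpands a (nnf P)
shannon-nnf¬ : ∀ a P → ShannonExpands a (nnf¬ P)
shannon-nnf a (var ())
shannon-nnf a T = expand-trivial
shannon-nnf a F = expand-trivial
shannon-nnf a (atom b) with a ≡ᵇ b | ≡ᵇ-reflects a b
... | true | ofʸ refl = expand-self
... | false | _ = expand-trivial
shannon-nnf a (¬' P) = shannon-nnf¬ a P
shannon-nnf a (P ∧• Q) = expand-∧ (shannon-nnf a P) (shannon-nnf a Q)
shannon-nnf a (P ∨• Q) = expand-∨ (shannon-nnf a P) (shannon-nnf a Q)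
shannon-nnf¬ a (var ())
shannon-nnf¬ a T = expand-trivial
shannon-nnf¬ a F = expand-trivial
shannon-nnf¬ a (atom b) with a ≡ᵇ b | ≡ᵇ-reflects a b
... | true | ofʸ refl = expand-¬self
... | false | _ = expand-trivial
shannon-nnf¬ a (¬' P) = shannon-nnf a P
shannon-nnf¬ a (P ∧• Q) = expand-∨ (shannon-nnf¬ a P) (shannon-nnf¬ a Q)
shannon-nnf¬ a (P ∨• Q) = expand-∧ (shannon-nnf¬ a P) (shannon-nnf¬ a Q)

-- At the empty list P is atom-free, so the valuation used for its value is irrelevant.
shannonNF : List Atom → SP → OTerm
shannonNF [] P = embed (bool (eval (λ _ → false) P))
shannonNF (a ∷ S) P =
  if occurs a P
  then shannonNF S (P [ a ≔ true ]) ◁ atom a ▷ shannonNF S (P [ a ≔ false ])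
  else shannonNF S P

shannonNF-cong : ∀ S {P Q} → P ≃ Q → shannonNF S P ≡ shannonNF S Q
shannonNF-cong [] P≃Q = cong (λ u → embed (bool u)) (P≃Q .same-value _)
shannonNF-cong (a ∷ S) {P} {Q} P≃Q rewrite P≃Q .same-alphabet a with occurs a Q
... | true = cong₂ (λ X Y → X ◁ atom a ▷ Y)
                   (shannonNF-cong S (≃-[≔] a true P≃Q)) (shannonNF-cong S (≃-[≔] a false P≃Q))
... | false = shannonNF-cong S P≃Q

infix 4 _⊆α_
_⊆α_ : SP → List Atom → Set
P ⊆α S = ∀ b → occurs b P ≡ true → b ∈ᵇ S ≡ true

⊆α-resp-≃ : ∀ {P Q S} → P ≃ Q → P ⊆α S → Q ⊆α S
⊆α-resp-≃ P≃Q P⊆S b occ = P⊆S b (trans (P≃Q .same-alphabet b) occ)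

⊆α-tail : ∀ {P a S} → P ⊆α a ∷ S → occurs a P ≡ false → P ⊆α S
⊆α-tail {a = a} P⊆aS a∉P b b∈P with b ≡ᵇ a | ≡ᵇ-reflects b a | P⊆aS b b∈P
... | true | ofʸ refl | _ with () ← trans (sym b∈P) a∉P
... | false | _ | b∈S = b∈S

⊆α-[≔] : ∀ {P a S} v → P ⊆α a ∷ S → P [ a ≔ v ] ⊆α S
⊆α-[≔] {P} {a} v P⊆aS b occ rewrite occurs-[≔] b a v P with a ≡ᵇ b | ≡ᵇ-reflects a b
... | false | ofⁿ a≢b with P⊆aS b occ
...   | b∈aS rewrite ≡ᵇ-≢ (λ b≡a → a≢b (sym b≡a)) = b∈aS

≡⇒≋ : ∀ {s t} → s ≡ t → s ≋ t
≡⇒≋ = Setoid.reflexive ≋-setoid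

shannonNF-correct : ∀ S P → P ⊆α S → embed P ≋ shannonNF S P
shannonNF-correct [] P P⊆[] = atomless≋value (λ _ → false) P atomless
  where
  atomless : ∀ b → occurs b P ≡ false
  atomless b with occurs b P in b∈P
  ... | true with () ← P⊆[] b b∈P
  ... | false = refl
shannonNF-correct (a ∷ S) P P⊆aS with occurs a P in a∈P
... | false = shannonNF-correct S P (⊆α-tail {P} {a} {S} P⊆aS a∈P)
... | true = begin
  embed P                                                      ≈⟨ embed-nnf P ⟩
  embed N                                                      ≈⟨ eff-∨-occurring a N (trans (N≃P .same-alphabet a) a∈P) ⟨
  eff (atom a) ∨• embed N                                      ≈⟨ shannon-nnf a P ⟩
  embed (N [ a ≔ true ]) ◁ atom a ▷ embed (N [ a ≔ false ])    ≈⟨ cong∨ (∧-congʳ (branch true)) (∧-congʳ (branch false)) ⟩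
  shannonNF S (P [ a ≔ true ]) ◁ atom a ▷ shannonNF S (P [ a ≔ false ])  ∎
  where
  N = nnf P
  N≃P : N ≃ P
  N≃P = ≋⇒≃ N P (sym' (embed-nnf P))
  branch : ∀ v → embed (N [ a ≔ v ]) ≋ shannonNF S (P [ a ≔ v ])
  branch v = trans' (shannonNF-correct S (N [ a ≔ v ]) (⊆α-[≔] {N} {a} {S} v (⊆α-resp-≃ {S = a ∷ S} (≃-sym N≃P) P⊆aS)))
                    (≡⇒≋ (shannonNF-cong S (≃-[≔] a v N≃P)))

≃⇒≋ : ∀ S {P Q} → P ⊆α S → P ≃ Q → embed P ≋ embed Q
≃⇒≋ S {P} {Q} P⊆S P≃Q =
  trans' (shannonNF-correct S P P⊆S)
         (trans' (≡⇒≋ (shannonNF-cong S P≃Q)) (sym' (shannonNF-correct S Q (⊆α-resp-≃ {S = S} P≃Q P⊆S))))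

-- Memorising evaluation trees

data AllNodes (Q : Atom → Set) : Tree → Set where
  Tl : AllNodes Q Tl
  Fl : AllNodes Q Fl
  node : ∀ {X a Y} → AllNodes Q X → Q a → AllNodes Q Y → AllNodes Q (node X a Y)

AllNodes-map : ∀ {Q Q′ X} → (∀ {b} → Q b → Q′ b) → AllNodes Q X → AllNodes Q′ X
AllNodes-map f Tl = Tl
AllNodes-map f Fl = Fl
AllNodes-map f (node X a Y) = node (AllNodes-map f X) (f a) (AllNodes-map f Y)

AllNodes-repl : ∀ {Q X Y Z} → AllNodes Q X → AllNodes Q Y → AllNodes Q Z → AllNodes Q (repl X Y Z)
AllNodes-repl Tl Y Z = Y
AllNodes-repl Fl Y Z = Z
AllNodes-repl (node X a X′) Y Z = node (AllNodes-repl X Y Z) a (AllNodes-repl X′ Y Z)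

AllNodes-L : ∀ {Q} a {X} → AllNodes Q X → AllNodes (λ b → b ≢ a × Q b) (L a X)
AllNodes-L a Tl = Tl
AllNodes-L a Fl = Fl
AllNodes-L a (node {X} {b} {Y} QX Qb QY) with a ≡ᵇ b | ≡ᵇ-reflects a b
... | true | ofʸ refl = AllNodes-L a QX
... | false | ofⁿ a≢b = node (AllNodes-L a QX) ((λ b≡a → a≢b (sym b≡a)) , Qb) (AllNodes-L a QY)

AllNodes-R : ∀ {Q} a {X} → AllNodes Q X → AllNodes (λ b → b ≢ a × Q b) (R a X)
AllNodes-R a Tl = Tl
AllNodes-R a Fl = Fl
AllNodes-R a (node {X} {b} {Y} QX Qb QY) with a ≡ᵇ b | ≡ᵇ-reflects a b
... | true | ofʸ refl = AllNodes-R a QY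
... | false | ofⁿ a≢b = node (AllNodes-R a QX) ((λ b≡a → a≢b (sym b≡a)) , Qb) (AllNodes-R a QY)

depth-L : ∀ a X → depth (L a X) ≤ depth X
depth-L a Tl = z≤n
depth-L a Fl = z≤n
depth-L a (node X b Y) with a ≡ᵇ b
... | true = ≤-trans (depth-L a X) (≤-trans (m≤m⊔n (depth X) (depth Y)) (n≤1+n _))
... | false = s≤s (⊔-mono-≤ (depth-L a X) (depth-L a Y))

depth-R : ∀ a X → depth (R a X) ≤ depth X
depth-R a Tl = z≤n
depth-R a Fl = z≤n
depth-R a (node X b Y) with a ≡ᵇ b
... | true = ≤-trans (depth-R a Y) (≤-trans (m≤n⊔m (depth X) (depth Y)) (n≤1+n _))
... | false = s≤s (⊔-mono-≤ (depth-R a X) (depth-R a Y))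

PartialValuation : Set
PartialValuation = Atom → Maybe Bool

∅ : PartialValuation
∅ _ = nothing

-- The transformation m, given the values π of the atoms already evaluated on the path.
memo : PartialValuation → Tree → Tree
memo π Tl = Tl
memo π Fl = Fl
memo π (node X a Y) with π a
... | just true = memo π X
... | just false = memo π Y
... | nothing = node (memo (π [ a ↦ just true ]) X) a (memo (π [ a ↦ just false ]) Y)

memo-L : ∀ π a X → π a ≡ just true → memo π (L a X) ≡ memo π X
memo-L π a Tl _ = refl
memo-L π a Fl _ = refl
memo-L π a (node X b Y) πa with a ≡ᵇ b | ≡ᵇ-reflects a b
... | true | ofʸ refl rewrite πa = memo-L π a X πa
... | false | ofⁿ a≢b with π b
...   | just true = memo-L π a X πa
...   | just false = memo-L π a Y πa
...   | nothing = cong₂ (λ X′ Y′ → node X′ b Y′)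
                        (memo-L _ a X (trans ([↦]-other π (just true) a≢b) πa))
                        (memo-L _ a Y (trans ([↦]-other π (just false) a≢b) πa))

memo-R : ∀ π a X → π a ≡ just false → memo π (R a X) ≡ memo π X
memo-R π a Tl _ = refl
memo-R π a Fl _ = refl
memo-R π a (node X b Y) πa with a ≡ᵇ b | ≡ᵇ-reflects a b
... | true | ofʸ refl rewrite πa = memo-R π a Y πa
... | false | ofⁿ a≢b with π b
...   | just true = memo-R π a X πa
...   | just false = memo-R π a Y πa
...   | nothing = cong₂ (λ X′ Y′ → node X′ b Y′)
                        (memo-R _ a X (trans ([↦]-other π (just true) a≢b) πa))
                        (memo-R _ a Y (trans ([↦]-other π (just false) a≢b) πa))

Unassigned : PartialValuation → Atom → Set
Unassigned π b = π b ≡ nothing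

m-fuel≡memo : ∀ n π X → depth X ≤ n → AllNodes (Unassigned π) X → m-fuel n X ≡ memo π X
m-fuel≡memo n π Tl _ _ = refl
m-fuel≡memo n π Fl _ _ = refl
m-fuel≡memo (suc n) π (node X a Y) (s≤s d) (node fresh-X πa fresh-Y) rewrite πa =
  cong₂ (λ X′ Y′ → node X′ a Y′)
    (trans (m-fuel≡memo n (π [ a ↦ just true ]) (L a X)
              (≤-trans (depth-L a X) (≤-trans (m≤m⊔n _ _) d)) (AllNodes-map still-fresh (AllNodes-L a fresh-X)))
           (memo-L _ a X ([↦]-same π a (just true))))
    (trans (m-fuel≡memo n (π [ a ↦ just false ]) (R a Y)
              (≤-trans (depth-R a Y) (≤-trans (m≤n⊔m _ _) d)) (AllNodes-map still-fresh (AllNodes-R a fresh-Y)))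
           (memo-R _ a Y ([↦]-same π a (just false))))
  where
  still-fresh : ∀ {v b} → b ≢ a × Unassigned π b → Unassigned (π [ a ↦ just v ]) b
  still-fresh (b≢a , πb) = trans ([↦]-other π _ b≢a) πb

m≡memo : ∀ X → m X ≡ memo ∅ X
m≡memo X = m-fuel≡memo (depth X) ∅ X ≤-refl (all-unassigned X)
  where
  all-unassigned : ∀ X → AllNodes (Unassigned ∅) X
  all-unassigned Tl = Tl
  all-unassigned Fl = Fl
  all-unassigned (node X a Y) = node (all-unassigned X) refl (all-unassigned Y)

evalᵀ : Valuation → Tree → Bool
evalᵀ ρ Tl = true
evalᵀ ρ Fl = false
evalᵀ ρ (node X a Y) = if ρ a then evalᵀ ρ X else evalᵀ ρ Y

Extends : Valuation → PartialValuation → Set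
Extends ρ π = ∀ b v → π b ≡ just v → ρ b ≡ v

Extends-[↦] : ∀ {ρ π a v} → Extends ρ π → ρ a ≡ v → Extends ρ (π [ a ↦ just v ])
Extends-[↦] {a = a} ρ⊇π ρa b w πb with a ≡ᵇ b | ≡ᵇ-reflects a b | πb
... | true | ofʸ refl | refl = ρa
... | false | _ | πb′ = ρ⊇π b w πb′

evalᵀ-memo : ∀ ρ π X → Extends ρ π → evalᵀ ρ (memo π X) ≡ evalᵀ ρ X
evalᵀ-memo ρ π Tl _ = refl
evalᵀ-memo ρ π Fl _ = refl
evalᵀ-memo ρ π (node X a Y) ρ⊇π with π a in πa
... | just true rewrite ρ⊇π a true πa = evalᵀ-memo ρ π X ρ⊇π
... | just false rewrite ρ⊇π a false πa = evalᵀ-memo ρ π Y ρ⊇π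
... | nothing with ρ a in ρa
...   | true = evalᵀ-memo ρ _ X (Extends-[↦] ρ⊇π ρa)
...   | false = evalᵀ-memo ρ _ Y (Extends-[↦] ρ⊇π ρa)

evalᵀ-repl : ∀ ρ X Y Z → evalᵀ ρ (repl X Y Z) ≡ (if evalᵀ ρ X then evalᵀ ρ Y else evalᵀ ρ Z)
evalᵀ-repl ρ Tl Y Z = refl
evalᵀ-repl ρ Fl Y Z = refl
evalᵀ-repl ρ (node X a X′) Y Z with ρ a
... | true = evalᵀ-repl ρ X Y Z
... | false = evalᵀ-repl ρ X′ Y Z

evalᵀ-fe : ∀ ρ P → evalᵀ ρ (fe P) ≡ eval ρ P
evalᵀ-fe ρ (var ())
evalᵀ-fe ρ T = refl
evalᵀ-fe ρ F = refl
evalᵀ-fe ρ (atom a) with ρ a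
... | true = refl
... | false = refl
evalᵀ-fe ρ (¬' P) rewrite evalᵀ-repl ρ (fe P) Fl Tl | evalᵀ-fe ρ P = negation (eval ρ P)
  where
  negation : ∀ u → (if u then false else true) ≡ not u
  negation true = refl
  negation false = refl
evalᵀ-fe ρ (P ∧• Q)
  rewrite evalᵀ-repl ρ (fe P) (fe Q) (repl (fe Q) Fl Fl) | evalᵀ-repl ρ (fe Q) Fl Fl
        | evalᵀ-fe ρ P | evalᵀ-fe ρ Q = conjunction (eval ρ P) (eval ρ Q)
  where
  conjunction : ∀ u v → (if u then v else (if v then false else false)) ≡ u ∧ v
  conjunction true v = refl
  conjunction false true = refl
  conjunction false false = refl
evalᵀ-fe ρ (P ∨• Q)
  rewrite evalᵀ-repl ρ (fe P) (repl (fe Q) Tl Tl) (fe Q) | evalᵀ-repl ρ (fe Q) Tl Tl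
        | evalᵀ-fe ρ P | evalᵀ-fe ρ Q = disjunction (eval ρ P) (eval ρ Q)
  where
  disjunction : ∀ u v → (if u then (if v then true else true) else v) ≡ u ∨ v
  disjunction false v = refl
  disjunction true true = refl
  disjunction true false = refl

keep-occurs : ∀ b P l → b ∈ᵇ keep P l ≡ occurs b P ∧ (b ∈ᵇ l)
keep-occurs b P [] = sym (𝔹.∧-zeroʳ _)
keep-occurs b P (a ∷ l) with occurs a P in a∈P
... | true with b ≡ᵇ a | ≡ᵇ-reflects b a
...   | true | ofʸ refl rewrite a∈P = refl
...   | false | _ = keep-occurs b P l
keep-occurs b P (a ∷ l) | false with b ≡ᵇ a | ≡ᵇ-reflects b a
...   | true | ofʸ refl rewrite a∈P = trans (keep-occurs b P l) (cong (_∧ (b ∈ᵇ l)) a∈P)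
...   | false | _ = keep-occurs b P l

occurs⇒≤maxAtom : ∀ b P → occurs b P ≡ true → b ≤ maxAtom P
occurs⇒≤maxAtom b (var ())
occurs⇒≤maxAtom b (atom a) b∈P with b ≡ᵇ a | ≡ᵇ-reflects b a
... | true | ofʸ refl = ≤-refl
occurs⇒≤maxAtom b (¬' P) b∈P = occurs⇒≤maxAtom b P b∈P
occurs⇒≤maxAtom b (P ∧• Q) b∈PQ with ∨-true⁻ (occurs b P) b∈PQ
... | inj₁ b∈P = ≤-trans (occurs⇒≤maxAtom b P b∈P) (m≤m⊔n _ _)
... | inj₂ b∈Q = ≤-trans (occurs⇒≤maxAtom b Q b∈Q) (m≤n⊔m _ _)
occurs⇒≤maxAtom b (P ∨• Q) b∈PQ with ∨-true⁻ (occurs b P) b∈PQ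
... | inj₁ b∈P = ≤-trans (occurs⇒≤maxAtom b P b∈P) (m≤m⊔n _ _)
... | inj₂ b∈Q = ≤-trans (occurs⇒≤maxAtom b Q b∈Q) (m≤n⊔m _ _)

maxAtom-mono : ∀ P Q → (∀ b → occurs b P ≡ true → occurs b Q ≡ true) → maxAtom P ≤ maxAtom Q
maxAtom-mono (var ())
maxAtom-mono T Q _ = z≤n
maxAtom-mono F Q _ = z≤n
maxAtom-mono (atom a) Q P⊆Q = occurs⇒≤maxAtom a Q (P⊆Q a (≡ᵇ-refl a))
maxAtom-mono (¬' P) Q P⊆Q = maxAtom-mono P Q P⊆Q
maxAtom-mono (P₁ ∧• P₂) Q P⊆Q =
  ⊔-lub (maxAtom-mono P₁ Q (λ b occ → P⊆Q b (∨-introˡ _ occ)))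
        (maxAtom-mono P₂ Q (λ b occ → P⊆Q b (∨-introʳ (occurs b P₁) occ)))
maxAtom-mono (P₁ ∨• P₂) Q P⊆Q =
  ⊔-lub (maxAtom-mono P₁ Q (λ b occ → P⊆Q b (∨-introˡ _ occ)))
        (maxAtom-mono P₂ Q (λ b occ → P⊆Q b (∨-introʳ (occurs b P₁) occ)))

keep-cong : ∀ {P Q} → (∀ a → occurs a P ≡ occurs a Q) → ∀ l → keep P l ≡ keep Q l
keep-cong same [] = refl
keep-cong {P} {Q} same (a ∷ l) rewrite same a with occurs a Q
... | true = cong (a ∷_) (keep-cong same l)
... | false = keep-cong same l

β-cong : ∀ {P Q} → (∀ a → occurs a P ≡ occurs a Q) → β P ≡ β Q
β-cong {P} {Q} same
  rewrite ≤-antisym (maxAtom-mono P Q (λ b occ → trans (sym (same b)) occ))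
                    (maxAtom-mono Q P (λ b occ → trans (same b) occ))
  = keep-cong same (upTo (suc (maxAtom Q)))

∈ᵇ-upTo : ∀ {b n} → b < n → b ∈ᵇ upTo n ≡ true
∈ᵇ-upTo {b} b<n = Equivalence.to 𝔹.T-≡ (any⁺ (b ≡ᵇ_) (Any.map (λ {c} → ≡⇒≡ᵇ b c) (∈-upTo⁺ b<n)))

∈ᵇ-β : ∀ b P → b ∈ᵇ β P ≡ occurs b P
∈ᵇ-β b P rewrite keep-occurs b P (upTo (suc (maxAtom P))) with occurs b P in b∈P
... | true = ∈ᵇ-upTo (s≤s (occurs⇒≤maxAtom b P b∈P))
... | false = refl

⊆α-β : ∀ P → P ⊆α β P
⊆α-β P b b∈P = trans (∈ᵇ-β b P) b∈P

-- clfe as a complete decision tree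

chain : List Atom → Tree → Tree
chain [] Z = Z
chain (a ∷ S) Z = node (chain S Z) a (chain S Z)

evalᵀ-chain : ∀ ρ S Z → evalᵀ ρ (chain S Z) ≡ evalᵀ ρ Z
evalᵀ-chain ρ [] Z = refl
evalᵀ-chain ρ (a ∷ S) Z with ρ a
... | true = evalᵀ-chain ρ S Z
... | false = evalᵀ-chain ρ S Z

repl-chain : ∀ S W Y Z → repl (chain S W) Y Z ≡ chain S (repl W Y Z)
repl-chain [] W Y Z = refl
repl-chain (a ∷ S) W Y Z = cong (λ C → node C a C) (repl-chain S W Y Z)

fe-F̃ : ∀ S → fe (F̃ S) ≡ chain S Fl
fe-F̃ [] = refl
fe-F̃ (a ∷ S) rewrite fe-F̃ S = cong (node (chain S Fl) a) (repl-chain S Fl Fl Fl)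

clfe≡memo-chain : ∀ P → clfe P ≡ memo ∅ (chain (β P) (fe P))
clfe≡memo-chain P =
  trans (m≡memo _)
        (cong (memo ∅) (trans (cong (λ C → repl C (repl (fe P) Tl Tl) (fe P)) (fe-F̃ (β P)))
                              (repl-chain (β P) Fl (repl (fe P) Tl Tl) (fe P))))

occursᵀ : Atom → Tree → Bool
occursᵀ b Tl = false
occursᵀ b Fl = false
occursᵀ b (node X a Y) = (b ≡ᵇ a) ∨ occursᵀ b X ∨ occursᵀ b Y

leaf : Bool → Tree
leaf true = Tl
leaf false = Fl

completion : PartialValuation → Valuation
completion π b = fromMaybe false (π b)

decisionTree : PartialValuation → List Atom → (Valuation → Bool) → Tree
decisionTree π [] f = leaf (f (completion π))
decisionTree π (a ∷ S) f with π a
... | just _ = decisionTree π S f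
... | nothing = node (decisionTree (π [ a ↦ just true ]) S f) a (decisionTree (π [ a ↦ just false ]) S f)

decisionTree-cong : ∀ π S {f g} → (∀ ρ → f ρ ≡ g ρ) → decisionTree π S f ≡ decisionTree π S g
decisionTree-cong π [] f≗g = cong leaf (f≗g (completion π))
decisionTree-cong π (a ∷ S) f≗g with π a
... | just _ = decisionTree-cong π S f≗g
... | nothing = cong₂ (λ X Y → node X a Y) (decisionTree-cong _ S f≗g) (decisionTree-cong _ S f≗g)

occursᵀ-decisionTree : ∀ b π S f → occursᵀ b (decisionTree π S f) ≡ (b ∈ᵇ S) ∧ is-nothing (π b)
occursᵀ-decisionTree b π [] f with f (completion π)
... | true = refl
... | false = refl
occursᵀ-decisionTree b π (a ∷ S) f with π a in πa | b ≡ᵇ a | ≡ᵇ-reflects b a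
... | just _ | true | ofʸ refl rewrite πa =
  trans (occursᵀ-decisionTree a π S f) (trans (cong (λ w → (a ∈ᵇ S) ∧ is-nothing w) πa) (𝔹.∧-zeroʳ _))
... | just _ | false | _ = occursᵀ-decisionTree b π S f
... | nothing | true | ofʸ refl rewrite πa | ≡ᵇ-refl b = refl
... | nothing | false | ofⁿ b≢a
  rewrite occursᵀ-decisionTree b (π [ a ↦ just true ]) S f | occursᵀ-decisionTree b (π [ a ↦ just false ]) S f
        | [↦]-other π (just true) b≢a | [↦]-other π (just false) b≢a | ≡ᵇ-≢ b≢a = 𝔹.∨-idem _

Assigned : PartialValuation → Atom → Set
Assigned π b = π b ≢ nothing

memo-assigned : ∀ π X → AllNodes (Assigned π) X → memo π X ≡ leaf (evalᵀ (completion π) X)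
memo-assigned π Tl _ = refl
memo-assigned π Fl _ = refl
memo-assigned π (node X a Y) (node assigned-X πa assigned-Y) with π a
... | just true = memo-assigned π X assigned-X
... | just false = memo-assigned π Y assigned-Y
... | nothing = ⊥-elim (πa refl)

assigned-just : ∀ π a {v} → π a ≡ just v → Assigned π a
assigned-just π a πa πa≡nothing with () ← trans (sym πa) πa≡nothing

data Covers (S : List Atom) (π : PartialValuation) (b : Atom) : Set where
  listed : b ∈ᵇ S ≡ true → Covers S π b
  assigned : Assigned π b → Covers S π b

Covers-tail : ∀ {S π a b} → Assigned π a → Covers (a ∷ S) π b → Covers S π b
Covers-tail πa (assigned πb) = assigned πb
Covers-tail {a = a} {b} πa (listed b∈aS) with b ≡ᵇ a | ≡ᵇ-reflects b a
... | true | ofʸ refl = assigned πa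
... | false | _ = listed b∈aS

Covers-[↦] : ∀ {S π a b} v → Covers S π b → Covers S (π [ a ↦ just v ]) b
Covers-[↦] v (listed b∈S) = listed b∈S
Covers-[↦] {π = π} {a} {b} v (assigned πb) with b ≡ᵇ a | ≡ᵇ-reflects b a
... | true | ofʸ refl = assigned (assigned-just (π [ a ↦ just v ]) a ([↦]-same π a (just v)))
... | false | ofⁿ b≢a = assigned (λ πb≡nothing → πb (trans (sym ([↦]-other π (just v) b≢a)) πb≡nothing))

memo-chain : ∀ π S Z → AllNodes (Covers S π) Z → memo π (chain S Z) ≡ decisionTree π S (λ ρ → evalᵀ ρ Z)
memo-chain π [] Z covered = memo-assigned π Z (AllNodes-map only-assigned covered)
  where
  only-assigned : ∀ {b} → Covers [] π b → Assigned π b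
  only-assigned (assigned πb) = πb
memo-chain π (a ∷ S) Z covered with π a in πa
... | just true = memo-chain π S Z (AllNodes-map (Covers-tail (assigned-just π a πa)) covered)
... | just false = memo-chain π S Z (AllNodes-map (Covers-tail (assigned-just π a πa)) covered)
... | nothing = cong₂ (λ X Y → node X a Y) (branch true) (branch false)
  where
  branch : ∀ v → memo (π [ a ↦ just v ]) (chain S Z) ≡ decisionTree (π [ a ↦ just v ]) S (λ ρ → evalᵀ ρ Z)
  branch v = memo-chain _ S Z
    (AllNodes-map (λ c → Covers-tail (assigned-just (π [ a ↦ just v ]) a ([↦]-same π a (just v))) (Covers-[↦] {a = a} v c)) covered)

fe-alphabet : ∀ P → AllNodes (λ b → occurs b P ≡ true) (fe P)
fe-alphabet (var ())
fe-alphabet T = Tl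
fe-alphabet F = Fl
fe-alphabet (atom a) = node Tl (≡ᵇ-refl a) Fl
fe-alphabet (¬' P) = AllNodes-repl (fe-alphabet P) Fl Tl
fe-alphabet (P ∧• Q) =
  AllNodes-repl (AllNodes-map (∨-introˡ _) (fe-alphabet P)) Q-nodes (AllNodes-repl Q-nodes Fl Fl)
  where Q-nodes = AllNodes-map (∨-introʳ (occurs _ P)) (fe-alphabet Q)
fe-alphabet (P ∨• Q) =
  AllNodes-repl (AllNodes-map (∨-introˡ _) (fe-alphabet P)) (AllNodes-repl Q-nodes Tl Tl) Q-nodes
  where Q-nodes = AllNodes-map (∨-introʳ (occurs _ P)) (fe-alphabet Q)

clfe≡decisionTree : ∀ P → clfe P ≡ decisionTree ∅ (β P) (λ ρ → evalᵀ ρ (fe P))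
clfe≡decisionTree P =
  trans (clfe≡memo-chain P)
        (memo-chain ∅ (β P) (fe P) (AllNodes-map (λ {b} b∈P → listed (trans (∈ᵇ-β b P) b∈P)) (fe-alphabet P)))

occursᵀ-clfe : ∀ b P → occursᵀ b (clfe P) ≡ occurs b P
occursᵀ-clfe b P rewrite clfe≡decisionTree P =
  trans (occursᵀ-decisionTree b ∅ (β P) (λ ρ → evalᵀ ρ (fe P))) (trans (𝔹.∧-identityʳ _) (∈ᵇ-β b P))

evalᵀ-clfe : ∀ ρ P → evalᵀ ρ (clfe P) ≡ eval ρ P
evalᵀ-clfe ρ P rewrite clfe≡memo-chain P =
  trans (evalᵀ-memo ρ ∅ (chain (β P) (fe P)) (λ _ _ ())) (trans (evalᵀ-chain ρ (β P) (fe P)) (evalᵀ-fe ρ P))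

≃⇒clfe≡ : ∀ {P Q} → P ≃ Q → clfe P ≡ clfe Q
≃⇒clfe≡ {P} {Q} P≃Q =
  trans (clfe≡decisionTree P)
        (trans (cong (λ S → decisionTree ∅ S (λ ρ → evalᵀ ρ (fe P))) (β-cong {P} {Q} (P≃Q .same-alphabet)))
               (trans (decisionTree-cong ∅ (β Q) same-function) (sym (clfe≡decisionTree Q))))
  where
  same-function : ∀ ρ → evalᵀ ρ (fe P) ≡ evalᵀ ρ (fe Q)
  same-function ρ = trans (evalᵀ-fe ρ P) (trans (P≃Q .same-value ρ) (sym (evalᵀ-fe ρ Q)))

clfe≡⇒≃ : ∀ {P Q} → clfe P ≡ clfe Q → P ≃ Q
clfe≡⇒≃ {P} {Q} eq .same-alphabet b = trans (sym (occursᵀ-clfe b P)) (trans (cong (occursᵀ b) eq) (occursᵀ-clfe b Q))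
clfe≡⇒≃ {P} {Q} eq .same-value ρ = trans (sym (evalᵀ-clfe ρ P)) (trans (cong (evalᵀ ρ) eq) (evalᵀ-clfe ρ Q))

theorem6p12 : (P Q : SP) →
    ((EqCℓFEL₂ ⊢ embed P ≈ embed Q) → clfe P ≡ clfe Q) ×
    (clfe P ≡ clfe Q → EqCℓFEL₂ ⊢ embed P ≈ embed Q)
theorem6p12 P Q =
  (λ P≋Q → ≃⇒clfe≡ (≋⇒≃ P Q P≋Q)) ,
  (λ clfe≡ → ≃⇒≋ (β P) (⊆α-β P) (clfe≡⇒≃ {P} {Q} clfe≡))
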